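{- Let $n,k$ be integers with $2\le k\le n-2$. If $W\subset\mathbb{Z}_n$ defines a relevant minor of $C_n^k$ with parameters $d=n_1=1$, isomorphic to $C_{n'}^{k'}$, then there exists $W'\subset W$ that defines a relevant minor of $C_n^k$ isomorphic to $C_{n''}^{k'}$ such that $n''\equiv1\pmod{k'}$ and $\lceil n''/k'\rceil\ge\lceil n'/k'\rceil$.
   Context: $\mathbb{Z}_n=\{0,\dots,n-1\}$ with arithmetic modulo $n$. $C_n^k$ is the $n\times n$ $0,1$ matrix with rows and columns indexed by $\mathbb{Z}_n$ whose $i$-th row is the incidence vector of $\{i,i+1,\dots,i+k-1\}\subset\mathbb{Z}_n$. For $N\subset\mathbb{Z}_n$, let $R(N)$ be the set of rows $j$ such that row $j$ of the column-submatrix of $C_n^k$ on columns $\mathbb{Z}_n\setminus N$ entrywise dominates some other row of that submatrix; the minor $C_n^k/N$ is the submatrix with rows $\mathbb{Z}_n\setminus R(N)$ and columns $\mathbb{Z}_n\setminus N$; a circulant minor is one isomorphic (up to row and column permutations) to some $C_{n'}^{k'}$. Let $G(C_n^k)$ be the digraph on $\mathbb{Z}_n$ with arcs $(i,i+k)$ (length $k$) and $(i,i+k+1)$ (length $k+1$). It is known that $C_n^k/N\approx C_{n'}^{k'}$ iff $N$ is the disjoint union of sets $N^0,\dots,N^{d-1}$, each the vertex set of a simple directed cycle of $G(C_n^k)$, all with the same number $n_2$ of arcs of length $k$ and $n_3$ of arcs of length $k+1$, where $n_1n=kn_2+(k+1)n_3$ with $n_1\ge1$, and $n'=n-d(n_2+n_3)$,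 $k'=k-dn_1$; $d,n_1,n_2,n_3$ are the parameters of the minor. With $W^j=\{i\in N^j:i-(k+1)\in N^j\}$ and $W=\bigcup_jW^j$, the set $W$ determines $N$ and the minor; $W$ is said to define the minor. The minor is relevant if $n'\not\equiv0\pmod{k'}$ and $\lceil n'/k'\rceil>\lceil n/k\rceil$. -}

module Defs where

open import Data.Nat using (ℕ; zero; suc; _+_; _*_; _∸_; _≤_; _<_)
open import Data.Nat.DivMod using (_%_; _/_)
open import Data.Bool using (Bool; true; false)
open import Data.Fin using (Fin; toℕ)
open import Data.Fin.Subset using (Subset) renaming (_∈_ to _∈ₛ_)
open import Data.List using (List; []; _∷_; map; length; sum; filter)
open import Data.List.Membership.Propositional using (_∈_)
open import Data.List.Relation.Unary.Unique.Propositional using (Unique)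
open import Data.Product using (Σ; ∃; ∃-syntax; _×_)
open import Relation.Binary.PropositionalEquality using (_≡_; _≢_)
open import Relation.Nullary using (¬_)
import Data.Bool
import Data.Empty
open import Function.Bundles using (_⇔_)

-- Total versions of "a mod b" and "⌈a/b⌉" (value for b = 0 is an
-- irrelevant convention; all uses below have b ≥ 1).
modN : ℕ → ℕ → ℕ
modN a zero    = a
modN a (suc b) = a % suc b

ceilDiv : ℕ → ℕ → ℕ
ceilDiv a zero    = zero
ceilDiv a (suc b) = (a + b) / suc b

-- a - b in ℤ_n, for a < n
subMod : ℕ → ℕ → ℕ → ℕ
subMod n a b = modN (a + (n ∸ modN b n)) n

stepLen : ℕ → Bool → ℕ
stepLen k false = k
stepLen k true  = suc k

-- unreduced positions of the closed walk starting at a with given steps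
-- (one position per step: v_0 = a, v_{t+1} = v_t + step_t)
positions : ℕ → ℕ → List Bool → List ℕ
positions k a []       = []
positions k a (b ∷ bs) = a ∷ positions k (a + stepLen k b) bs

count : Bool → List Bool → ℕ
count false bs = length (filter (λ b → Data.Bool._≟_ b false) bs)
count true  bs = length (filter (λ b → Data.Bool._≟_ b true) bs)

-- A closed walk in G(C_n^k) with pairwise distinct vertices (a simple
-- directed cycle).  Closure is enforced in MinorData via the equation
-- n1 * n ≡ k * n2 + (k+1) * n3 on the numbers of arcs.
record Cycle (n k : ℕ) : Set where
  field
    start    : Fin n
    steps    : List Bool
    nonempty : 1 ≤ length steps
  vertices : List ℕ
  vertices = map (λ x → modN x n) (positions k (toℕ start) steps)
  field
    distinct : Unique vertices
  n₂ : ℕ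
  n₂ = count false steps
  n₃ : ℕ
  n₃ = count true steps

open Cycle public

InN : ∀ {n k} → Cycle n k → Fin n → Set
InN C i = toℕ i ∈ vertices C

InW : ∀ {n k} → Cycle n k → Fin n → Set
InW {n} {k} C i = toℕ i ∈ vertices C × subMod n (toℕ i) (suc k) ∈ vertices C

record MinorData (n k d n1 n2 n3 : ℕ) : Set where
  field
    cyc      : Fin d → Cycle n k
    n2-eq    : ∀ j → n₂ (cyc j) ≡ n2
    n3-eq    : ∀ j → n₃ (cyc j) ≡ n3
    n1-pos   : 1 ≤ n1
    winding  : n1 * n ≡ k * n2 + suc k * n3
    disjoint : ∀ j j' → j ≢ j' → ∀ i → InN (cyc j) i → InN (cyc j') i → Data.Empty.⊥

Defines : (n k : ℕ) → Subset n → (d n1 n2 n3 : ℕ) → Set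
Defines n k W d n1 n2 n3 =
  Σ (MinorData n k d n1 n2 n3) λ D →
    ∀ i → (i ∈ₛ W) ⇔ (∃[ j ] InW (MinorData.cyc D j) i)

n′ : (n d n2 n3 : ℕ) → ℕ
n′ n d n2 n3 = n ∸ d * (n2 + n3)

k′ : (k d n1 : ℕ) → ℕ
k′ k d n1 = k ∸ d * n1

Relevant : (n k a b : ℕ) → Set
Relevant n k a b = (1 ≤ b) × (¬ (modN a b ≡ 0)) × (ceilDiv n k < ceilDiv a b)

-- Write k′ = k − 1.  For a one-cycle minor n′ = k′(n₂ + n₃) + n₃, so n′ ≡ n₃ (mod k′); write
-- n₃ = r + q k′ with 1 ≤ r < k′.  Relevance forces q ≥ r, so the cycle has at least k(r − 1)
-- arcs of length k + 1.  Replacing k(r − 1) of them by (k + 1)(r − 1) arcs of length k keeps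
-- the total length n, hence gives again a simple cycle of G(C_n^k), and lowers n′ by r − 1 to
-- n″ ≡ 1 (mod k′) without changing ⌈n′/k′⌉.  Every long arc of the new cycle is a long arc of
-- the old one, so the set W′ it defines lies in W.
module Submission where

open import Defs
open import Data.Bool using (Bool; true; false)
open import Data.Bool.Properties using (T-≡)
open import Data.Empty using (⊥-elim)
open import Data.Fin using (Fin; zero; toℕ; fromℕ<)
open import Data.Fin.Properties using (toℕ-fromℕ<; toℕ<n)
open import Data.Fin.Subset using (Subset; _⊆_) renaming (_∈_ to _∈ₛ_)
open import Data.List using (List; []; _∷_; _++_; map; replicate; length; filter)
open import Data.List.Properties using (∷-injective; length-++; filter-++)
open import Data.List.Membership.Propositional using (_∈_)
open import Data.List.Membership.Propositional.Properties using (∈-map⁺; ∈-map⁻)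
open import Data.List.Relation.Unary.Any using (here; there)
import Data.List.Relation.Unary.All as All
open import Data.List.Relation.Unary.AllPairs using ([]; _∷_)
open import Data.List.Relation.Unary.Unique.Propositional using (Unique)
open import Data.Nat using (ℕ; zero; suc; _+_; _*_; _∸_; _≤_; _≥_; _<_; _<?_; _≟_; NonZero; z≤n; s≤s)
open import Data.List.Membership.DecPropositional _≟_ using (_∈?_)
open import Data.Nat.DivMod
open import Data.Nat.Divisibility using (divides)
open import Data.Nat.Properties
open import Data.Nat.Tactic.RingSolver using (solve-∀)
open import Data.Product using (Σ; ∃; ∃-syntax; _×_; _,_; proj₁; proj₂; map₁)
open import Data.Sum using (_⊎_; inj₁; inj₂)
open import Data.Vec using (tabulate)
open import Data.Vec.Properties using (lookup∘tabulate; []=⇒lookup; lookup⇒[]=)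
open import Function.Bundles using (_⇔_; mk⇔; Equivalence)
open import Relation.Binary.PropositionalEquality
  using (_≡_; _≢_; refl; sym; trans; cong; cong₂; subst; module ≡-Reasoning)
open import Relation.Nullary using (¬_; does; yes; no)
open import Relation.Nullary.Decidable using (_×-dec_; dec-true; toWitness; isYes≗does)
open import Relation.Unary using (Decidable)

[m+kn]/n≡k : ∀ m k n .{{_ : NonZero n}} → m < n → (m + k * n) / n ≡ k
[m+kn]/n≡k m k n m<n = begin
  (m + k * n) / n    ≡⟨ +-distrib-/-∣ʳ m (divides k refl) ⟩
  m / n + k * n / n  ≡⟨ cong₂ _+_ (m<n⇒m/n≡0 m<n) (m*n/n≡m k n) ⟩
  k                  ∎
  where open ≡-Reasoning

ceilDiv-[1+m+kn] : ∀ m k b → m ≤ b → ceilDiv (suc m + k * suc b) (suc b) ≡ suc k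
ceilDiv-[1+m+kn] m k b m≤b = begin
  (suc m + k * suc b + b) / suc b  ≡⟨ cong (_/ suc b) (regroup m k b) ⟩
  (m + suc k * suc b) / suc b      ≡⟨ [m+kn]/n≡k m (suc k) (suc b) (s≤s m≤b) ⟩
  suc k                            ∎
  where
  open ≡-Reasoning
  regroup : ∀ m k b → suc m + k * suc b + b ≡ m + suc k * suc b
  regroup = solve-∀

[m%n+o]%n≡[m+o]%n : ∀ m o n .{{_ : NonZero n}} → (m % n + o) % n ≡ (m + o) % n
[m%n+o]%n≡[m+o]%n m o n = begin
  (m % n + o) % n            ≡⟨ %-distribˡ-+ (m % n) o n ⟩
  (m % n % n + o % n) % n    ≡⟨ cong (λ r → (r + o % n) % n) (m%n%n≡m%n m n) ⟩
  (m % n + o % n) % n        ≡⟨ %-distribˡ-+ m o n ⟨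
  (m + o) % n                ∎
  where open ≡-Reasoning

%-injective-window : ∀ n .{{_ : NonZero n}} {x y} → x % n ≡ y % n → x ≤ y → y < x + n → x ≡ y
%-injective-window n {x} {y} x%n≡y%n x≤y y<x+n =
  trans (m≡m%n+[m/n]*n x n) (trans (cong₂ (λ r q → r + q * n) x%n≡y%n x/n≡y/n) (sym (m≡m%n+[m/n]*n y n)))
  where
  y/n<1+x/n : x % n + y / n * n < x % n + suc (x / n) * n
  y/n<1+x/n = begin-strict
    x % n + y / n * n      ≡⟨ cong (_+ y / n * n) x%n≡y%n ⟩
    y % n + y / n * n      ≡⟨ m≡m%n+[m/n]*n y n ⟨
    y                      <⟨ y<x+n ⟩
    x + n                  ≡⟨ cong (_+ n) (m≡m%n+[m/n]*n x n) ⟩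
    x % n + x / n * n + n  ≡⟨ +-assoc (x % n) (x / n * n) n ⟩
    x % n + (x / n * n + n) ≡⟨ cong (x % n +_) (+-comm (x / n * n) n) ⟩
    x % n + suc (x / n) * n ∎
    where open ≤-Reasoning
  x/n≡y/n : x / n ≡ y / n
  x/n≡y/n = ≤-antisym (/-monoˡ-≤ n x≤y)
    (m<1+n⇒m≤n (*-cancelʳ-< n (y / n) (suc (x / n)) (+-cancelˡ-< (x % n) _ _ y/n<1+x/n)))

n′-of-split : ∀ {N} n2 n3 c → N ≡ (n2 + n3) + c → n′ N 1 n2 n3 ≡ c
n′-of-split n2 n3 c refl = trans (cong ((n2 + n3) + c ∸_) (*-identityˡ (n2 + n3))) (m+n∸m≡n (n2 + n3) c)

ceilDiv-suc≡ceilDiv : ∀ b s q e → q + e ≤ b →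
  ceilDiv (suc (suc b) * s + (suc (q + e) + q * suc b)) (suc (suc b)) ≡
  ceilDiv (suc b * s + (suc (q + e) + q * suc b)) (suc b)
ceilDiv-suc≡ceilDiv b s q e q+e≤b = begin
  ceilDiv (suc (suc b) * s + (suc (q + e) + q * suc b)) (suc (suc b))
    ≡⟨ cong (λ m → ceilDiv m (suc (suc b))) (regroupˡ b s q e) ⟩
  ceilDiv (suc e + (s + q) * suc (suc b)) (suc (suc b))
    ≡⟨ ceilDiv-[1+m+kn] e (s + q) (suc b) (≤-trans (m≤n+m e q) (m≤n⇒m≤1+n q+e≤b)) ⟩
  suc (s + q)
    ≡⟨ ceilDiv-[1+m+kn] (q + e) (s + q) b q+e≤b ⟨
  ceilDiv (suc (q + e) + (s + q) * suc b) (suc b)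
    ≡⟨ cong (λ m → ceilDiv m (suc b)) (regroupʳ b s q e) ⟩
  ceilDiv (suc b * s + (suc (q + e) + q * suc b)) (suc b) ∎
  where
  open ≡-Reasoning
  regroupˡ : ∀ b s q e → suc (suc b) * s + (suc (q + e) + q * suc b) ≡ suc e + (s + q) * suc (suc b)
  regroupˡ = solve-∀
  regroupʳ : ∀ b s q e → suc (q + e) + (s + q) * suc b ≡ suc b * s + (suc (q + e) + q * suc b)
  regroupʳ = solve-∀

n′-single-cycle : ∀ D {N} n2 n3 → N ≡ suc D * n2 + suc (suc D) * n3 → n′ N 1 n2 n3 ≡ D * (n2 + n3) + n3
n′-single-cycle D n2 n3 N≡ = n′-of-split n2 n3 _ (trans N≡ (regroup D n2 n3))
  where
  regroup : ∀ D n2 n3 → suc D * n2 + suc (suc D) * n3 ≡ (n2 + n3) + (D * (n2 + n3) + n3)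
  regroup = solve-∀

few-long-arcs⇒ceilDivs-equal : ∀ b {N} n2 n3 q e → N ≡ suc (suc b) * n2 + suc (suc (suc b)) * n3 →
  n3 ≡ suc (q + e) + q * suc b → q + e ≤ b → ceilDiv N (suc (suc b)) ≡ ceilDiv (n′ N 1 n2 n3) (suc b)
few-long-arcs⇒ceilDivs-equal b {N} n2 n3 q e N≡ n3≡ q+e≤b = begin
  ceilDiv N (suc D)                                   ≡⟨ cong (λ m → ceilDiv m (suc D)) N≡ ⟩
  ceilDiv (suc D * n2 + suc (suc D) * n3) (suc D)     ≡⟨ cong (λ m → ceilDiv m (suc D)) (regroup D n2 n3) ⟩
  ceilDiv (suc D * s + n3) (suc D)                    ≡⟨ cong (λ m → ceilDiv (suc D * s + m) (suc D)) n3≡ ⟩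
  ceilDiv (suc D * s + (suc (q + e) + q * D)) (suc D) ≡⟨ ceilDiv-suc≡ceilDiv b s q e q+e≤b ⟩
  ceilDiv (D * s + (suc (q + e) + q * D)) D           ≡⟨ cong (λ m → ceilDiv (D * s + m) D) n3≡ ⟨
  ceilDiv (D * s + n3) D                              ≡⟨ cong (λ m → ceilDiv m D) (n′-single-cycle D n2 n3 N≡) ⟨
  ceilDiv (n′ N 1 n2 n3) D                            ∎
  where
  open ≡-Reasoning
  D s : ℕ
  D = suc b
  s = n2 + n3
  regroup : ∀ D n2 n3 → suc D * n2 + suc (suc D) * n3 ≡ suc D * (n2 + n3) + n3
  regroup = solve-∀

relevant⇒long-arc-surplus : ∀ b {N} n2 n3 → N ≡ suc (suc b) * n2 + suc (suc (suc b)) * n3 →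
  Relevant N (suc (suc b)) (n′ N 1 n2 n3) (suc b) →
  ∃[ t ] ∃[ x ] suc t < suc b × n3 ≡ suc (suc b) * t + suc (x * suc b)
relevant⇒long-arc-surplus b {N} n2 n3 N≡ (_ , n′≢0 , ceil<) = decompose (n3 % D) refl
  where
  D q : ℕ
  D = suc b
  q = n3 / D
  n′%D≡n3%D : n′ N 1 n2 n3 % D ≡ n3 % D
  n′%D≡n3%D = begin
    n′ N 1 n2 n3 % D            ≡⟨ cong (_% D) (n′-single-cycle D n2 n3 N≡) ⟩
    (D * (n2 + n3) + n3) % D    ≡⟨ cong (_% D) (+-comm (D * (n2 + n3)) n3) ⟩
    (n3 + D * (n2 + n3)) % D    ≡⟨ cong (λ m → (n3 + m) % D) (*-comm D (n2 + n3)) ⟩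
    (n3 + (n2 + n3) * D) % D    ≡⟨ [m+kn]%n≡m%n n3 (n2 + n3) D ⟩
    n3 % D                      ∎
    where open ≡-Reasoning
  decompose : ∀ r → n3 % D ≡ r → ∃[ t ] ∃[ x ] suc t < D × n3 ≡ suc D * t + suc (x * D)
  decompose zero    r≡0 = ⊥-elim (n′≢0 (trans n′%D≡n3%D r≡0))
  decompose (suc t) r≡  = t , q ∸ t , 1+t<D , trans n3≡ (regroup D t (q ∸ t))
    where
    1+t<D : suc t < D
    1+t<D = subst (_< D) r≡ (m%n<n n3 D)
    n3≡1+t+qD : n3 ≡ suc t + q * D
    n3≡1+t+qD = trans (m≡m%n+[m/n]*n n3 D) (cong (_+ q * D) r≡)
    t<q : t < q
    t<q = ≰⇒> λ q≤t → <-irrefl (few-long-arcs⇒ceilDivs-equal b n2 n3 q (t ∸ q) N≡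
      (subst (λ t → n3 ≡ suc t + q * D) (sym (m+[n∸m]≡n q≤t)) n3≡1+t+qD)
      (subst (_≤ b) (sym (m+[n∸m]≡n q≤t)) (<⇒≤ (≤-pred 1+t<D)))) ceil<
    n3≡ : n3 ≡ suc t + (t + (q ∸ t)) * D
    n3≡ = trans n3≡1+t+qD (cong (λ m → suc t + m * D) (sym (m+[n∸m]≡n (<⇒≤ t<q))))
    regroup : ∀ D t x → suc t + (t + x) * D ≡ suc D * t + suc (x * D)
    regroup = solve-∀

exchange-numbers : ∀ b {N} n2 n3 m2 m3 t x → let D = suc b in
  N ≡ suc D * n2 + suc (suc D) * n3 → suc t < D →
  n3 ≡ suc D * t + suc (x * D) → n3 ≡ suc D * t + m3 → m2 ≡ n2 + suc (suc D) * t →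
  modN (n′ N 1 m2 m3) D ≡ modN 1 D × ¬ modN (n′ N 1 m2 m3) D ≡ 0 ×
  ceilDiv (n′ N 1 m2 m3) D ≡ ceilDiv (n′ N 1 n2 n3) D
exchange-numbers b n2 _ _ _ t x refl 1+t<D refl n3≡ refl
  with +-cancelˡ-≡ (suc (suc b) * t) _ _ n3≡
... | refl = n″%D≡1%D , n″%D≢0 , ceilDivs-equal
  where
  D m2 X : ℕ
  D = suc b
  m2 = n2 + suc (suc D) * t
  X = m2 + suc (x * D) + x
  n″≡ : n′ _ 1 m2 (suc (x * D)) ≡ suc (X * D)
  n″≡ = n′-of-split m2 (suc (x * D)) _ (regroup b n2 t x)
    where
    regroup : ∀ b n2 t x → let D = suc b; m2 = n2 + suc (suc D) * t; m3 = suc (x * D) in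
      suc D * n2 + suc (suc D) * (suc D * t + m3) ≡ (m2 + m3) + suc ((m2 + m3 + x) * D)
    regroup = solve-∀
  n′≡ : n′ _ 1 n2 (suc D * t + suc (x * D)) ≡ suc t + X * D
  n′≡ = n′-of-split n2 (suc D * t + suc (x * D)) _ (regroup b n2 t x)
    where
    regroup : ∀ b n2 t x → let D = suc b; m2 = n2 + suc (suc D) * t; m3 = suc (x * D) in
      suc D * n2 + suc (suc D) * (suc D * t + m3) ≡ (n2 + (suc D * t + m3)) + suc (t + (m2 + m3 + x) * D)
    regroup = solve-∀
  n″%D≡1%D : n′ _ 1 m2 (suc (x * D)) % D ≡ 1 % D
  n″%D≡1%D = trans (cong (_% D) n″≡) ([m+kn]%n≡m%n 1 X D)
  n″%D≢0 : ¬ n′ _ 1 m2 (suc (x * D)) % D ≡ 0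
  n″%D≢0 n″%D≡0 = 1+n≢0 (trans (sym (m<n⇒m%n≡m (≤-trans (s≤s (s≤s z≤n)) 1+t<D))) (trans (sym n″%D≡1%D) n″%D≡0))
  ceilDivs-equal : ceilDiv (n′ _ 1 m2 (suc (x * D))) D ≡ ceilDiv (n′ _ 1 n2 (suc D * t + suc (x * D))) D
  ceilDivs-equal = begin
    ceilDiv (n′ _ 1 m2 (suc (x * D))) D            ≡⟨ cong (λ m → ceilDiv m D) n″≡ ⟩
    ceilDiv (suc (X * D)) D                        ≡⟨ ceilDiv-[1+m+kn] 0 X b z≤n ⟩
    suc X                                          ≡⟨ ceilDiv-[1+m+kn] t X b (<⇒≤ (≤-pred 1+t<D)) ⟨
    ceilDiv (suc t + X * D) D                      ≡⟨ cong (λ m → ceilDiv m D) n′≡ ⟨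
    ceilDiv (n′ _ 1 n2 (suc D * t + suc (x * D))) D ∎
    where open ≡-Reasoning

walkLength : ℕ → List Bool → ℕ
walkLength k []       = 0
walkLength k (b ∷ bs) = stepLen k b + walkLength k bs

path : ℕ → ℕ → List Bool → List ℕ
path k a []       = a ∷ []
path k a (b ∷ bs) = a ∷ path k (a + stepLen k b) bs

k≤stepLen : ∀ k b → k ≤ stepLen k b
k≤stepLen k false = ≤-refl
k≤stepLen k true  = n≤1+n k

walkLength-++ : ∀ k xs ys → walkLength k (xs ++ ys) ≡ walkLength k xs + walkLength k ys
walkLength-++ k []       ys = refl
walkLength-++ k (x ∷ xs) ys =
  trans (cong (stepLen k x +_) (walkLength-++ k xs ys)) (sym (+-assoc (stepLen k x) _ _))

walkLength-replicate : ∀ k M → walkLength k (replicate M false) ≡ k * M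
walkLength-replicate k zero    = sym (*-zeroʳ k)
walkLength-replicate k (suc M) = trans (cong (k +_) (walkLength-replicate k M)) (sym (*-suc k M))

walkLength-count : ∀ k bs → walkLength k bs ≡ k * count false bs + suc k * count true bs
walkLength-count k []           = sym (cong₂ _+_ (*-zeroʳ k) (*-zeroʳ (suc k)))
walkLength-count k (false ∷ bs) = trans (cong (k +_) (walkLength-count k bs)) (regroup k _ _)
  where
  regroup : ∀ k f t → k + (k * f + suc k * t) ≡ k * suc f + suc k * t
  regroup = solve-∀
walkLength-count k (true ∷ bs)  = trans (cong (suc k +_) (walkLength-count k bs)) (regroup k _ _)
  where
  regroup : ∀ k f t → suc k + (k * f + suc k * t) ≡ k * f + suc k * suc t
  regroup = solve-∀

walkLength≡suc⇒nonempty : ∀ {k bs m} → walkLength k bs ≡ suc m → 1 ≤ length bs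
walkLength≡suc⇒nonempty {bs = _ ∷ _} _ = s≤s z≤n

module _ {k : ℕ} where

  start∈path : ∀ a bs → a ∈ path k a bs
  start∈path a []      = here refl
  start∈path a (_ ∷ _) = here refl

  end∈path : ∀ a bs → a + walkLength k bs ∈ path k a bs
  end∈path a []       = here (+-identityʳ a)
  end∈path a (b ∷ bs) =
    there (subst (_∈ path k (a + stepLen k b) bs) (+-assoc a _ _) (end∈path (a + stepLen k b) bs))

  positions⊆path : ∀ {a bs y} → y ∈ positions k a bs → y ∈ path k a bs
  positions⊆path {bs = _ ∷ _} (here y≡a) = here y≡a
  positions⊆path {bs = _ ∷ _} (there y∈) = there (positions⊆path y∈)

  path-split : ∀ {a bs z} → z ∈ path k a bs → z ∈ positions k a bs ⊎ z ≡ a + walkLength k bs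
  path-split {a} {[]}    (here refl) = inj₂ (sym (+-identityʳ a))
  path-split {bs = _ ∷ _} (here z≡a) = inj₁ (here z≡a)
  path-split {a} {b ∷ bs} (there z∈) with path-split z∈
  ... | inj₁ z∈ps = inj₁ (there z∈ps)
  ... | inj₂ z≡   = inj₂ (trans z≡ (+-assoc a _ _))

  path-lb : ∀ {a bs z} → z ∈ path k a bs → a ≤ z
  path-lb {bs = []}    (here refl) = ≤-refl
  path-lb {bs = _ ∷ _} (here refl) = ≤-refl
  path-lb {a} {b ∷ bs} (there z∈)  = ≤-trans (m≤m+n a _) (path-lb z∈)

  path-gap : ∀ {a bs z} → z ∈ path k a bs → z ≡ a ⊎ a + k ≤ z
  path-gap {bs = []}    (here z≡a) = inj₁ z≡a
  path-gap {bs = _ ∷ _} (here z≡a) = inj₁ z≡a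
  path-gap {a} {b ∷ bs} (there z∈) = inj₂ (≤-trans (+-monoʳ-≤ a (k≤stepLen k b)) (path-lb z∈))

  positions-ub : ∀ {a bs y} → y ∈ positions k a bs → y + k ≤ a + walkLength k bs
  positions-ub {a} {b ∷ bs} (here refl) = +-monoʳ-≤ a (≤-trans (k≤stepLen k b) (m≤m+n _ _))
  positions-ub {a} {b ∷ bs} (there y∈)  = ≤-trans (positions-ub y∈) (≤-reflexive (+-assoc a _ _))

LongArc : ℕ → ℕ → List Bool → ℕ → Set
LongArc k a bs y = ∃[ xs ] ∃[ ys ] (bs ≡ xs ++ true ∷ ys × y ≡ a + walkLength k xs)

module _ {k : ℕ} where

  longArc-∷ : ∀ {a b bs y} → LongArc k (a + stepLen k b) bs y → LongArc k a (b ∷ bs) y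
  longArc-∷ {a} {b} (xs , ys , refl , refl) = b ∷ xs , ys , refl , +-assoc a _ _

  longArc-++ˡ : ∀ {a} xs {bs y} → LongArc k (a + walkLength k xs) bs y → LongArc k a (xs ++ bs) y
  longArc-++ˡ {a} []       {bs} {y} arc = subst (λ c → LongArc k c bs y) (+-identityʳ a) arc
  longArc-++ˡ {a} (x ∷ xs) {bs} {y} arc =
    longArc-∷ (longArc-++ˡ xs (subst (λ c → LongArc k c bs y) (sym (+-assoc a _ _)) arc))

  longArc-padded : ∀ {a} bs M {y} → LongArc k a (bs ++ replicate M false) y → LongArc k a bs y
  longArc-padded []       M (xs , ys , eq , _) = ⊥-elim (noLongArc M xs eq)
    where
    noLongArc : ∀ M xs {ys} → replicate M false ≢ xs ++ true ∷ ys
    noLongArc zero    []       ()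
    noLongArc zero    (_ ∷ _)  ()
    noLongArc (suc M) []       ()
    noLongArc (suc M) (_ ∷ xs) eq = noLongArc M xs (proj₂ (∷-injective eq))
  longArc-padded (b ∷ bs) M ([] , ys , eq , y≡) with ∷-injective eq
  ... | refl , _ = [] , bs , refl , y≡
  longArc-padded {a} (b ∷ bs) M (x ∷ xs , ys , eq , y≡) with ∷-injective eq
  ... | refl , eq′ =
    longArc-∷ (longArc-padded bs M (xs , ys , eq′ , trans y≡ (sym (+-assoc a (stepLen k x) _))))

  longArc⇒∈positions : ∀ {a bs y} → LongArc k a bs y → y ∈ positions k a bs
  longArc⇒∈positions {a} ([] , ys , refl , refl) = here (+-identityʳ a)
  longArc⇒∈positions {a} (x ∷ xs , ys , refl , refl) =
    there (longArc⇒∈positions (xs , ys , refl , sym (+-assoc a (stepLen k x) _)))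

  longArc⇒∈path : ∀ {a bs y} → LongArc k a bs y → y + suc k ∈ path k a bs
  longArc⇒∈path {a} ([] , ys , refl , refl) =
    there (subst (_∈ path k (a + suc k) ys) (cong (_+ suc k) (sym (+-identityʳ a))) (start∈path _ ys))
  longArc⇒∈path {a} (x ∷ xs , ys , refl , refl) =
    there (longArc⇒∈path (xs , ys , refl , sym (+-assoc a (stepLen k x) _)))

  -- the vertex after y is y + k or y + (k+1), and the one after that lies beyond y + (k+1) as k ≥ 2
  gap⇒longArc : 2 ≤ k → ∀ {a bs y} → y ∈ positions k a bs → y + suc k ∈ path k a bs → LongArc k a bs y
  gap⇒longArc _ {a} {b ∷ bs} (here refl) (here a+k+1≡a) = ⊥-elim (m+1+n≢m a a+k+1≡a)
  gap⇒longArc 2≤k {a} {b ∷ bs} (here refl) (there z∈) with path-gap z∈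
  ... | inj₁ a+k+1≡ = arcFrom b (+-cancelˡ-≡ a _ _ a+k+1≡)
    where
    arcFrom : ∀ b → suc k ≡ stepLen k b → LongArc k a (b ∷ bs) a
    arcFrom false k+1≡k = ⊥-elim (<-irrefl (sym k+1≡k) (n<1+n k))
    arcFrom true  _     = [] , bs , refl , sym (+-identityʳ a)
  ... | inj₂ ≤a+k+1 = ⊥-elim (<⇒≱ (begin-strict
    a + suc k                ≡⟨ +-suc a k ⟩
    suc (a + k)              ≡⟨ +-comm 1 (a + k) ⟩
    a + k + 1                <⟨ +-monoʳ-< (a + k) 2≤k ⟩
    a + k + k                ≤⟨ +-monoˡ-≤ k (+-monoʳ-≤ a (k≤stepLen k b)) ⟩
    a + stepLen k b + k      ∎) ≤a+k+1)
    where open ≤-Reasoning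
  gap⇒longArc _ {a} {b ∷ bs} {y} (there y∈) (here y+k+1≡a) = ⊥-elim (<⇒≢ a<y+k+1 (sym y+k+1≡a))
    where
    a≤y : a ≤ y
    a≤y = ≤-trans (m≤m+n a _) (path-lb (positions⊆path y∈))
    a<y+k+1 : a < y + suc k
    a<y+k+1 = ≤-trans (s≤s (≤-trans a≤y (m≤m+n y k))) (≤-reflexive (sym (+-suc y k)))
  gap⇒longArc 2≤k {bs = _ ∷ _} (there y∈) (there z∈) = longArc-∷ (gap⇒longArc 2≤k y∈ z∈)

module CycleGeometry (n0 k : ℕ) where

  N : ℕ
  N = suc n0

  cycleVertices : ℕ → List Bool → List ℕ
  cycleVertices a bs = map (_% N) (positions k a bs)

  [subMod+b]%N≡a : ∀ a b → a < N → b < N → (subMod N a b + b) % N ≡ a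
  [subMod+b]%N≡a a b a<N b<N = begin
    ((a + (N ∸ b % N)) % N + b) % N  ≡⟨ [m%n+o]%n≡[m+o]%n (a + (N ∸ b % N)) b N ⟩
    (a + (N ∸ b % N) + b) % N        ≡⟨ cong (λ c → (a + (N ∸ c) + b) % N) (m<n⇒m%n≡m b<N) ⟩
    (a + (N ∸ b) + b) % N            ≡⟨ cong (_% N) (trans (+-assoc a _ b) (cong (a +_) (m∸n+n≡m (<⇒≤ b<N)))) ⟩
    (a + N) % N                      ≡⟨ [m+n]%n≡m%n a N ⟩
    a % N                            ≡⟨ m<n⇒m%n≡m a<N ⟩
    a                                ∎
    where open ≡-Reasoning

  cycleVertices-cong : ∀ {a a′} bs → a % N ≡ a′ % N → cycleVertices a bs ≡ cycleVertices a′ bs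
  cycleVertices-cong []       _      = refl
  cycleVertices-cong {a} {a′} (b ∷ bs) a≡a′ = cong₂ _∷_ a≡a′ (cycleVertices-cong bs (begin
    (a + stepLen k b) % N         ≡⟨ [m%n+o]%n≡[m+o]%n a (stepLen k b) N ⟨
    (a % N + stepLen k b) % N     ≡⟨ cong (λ r → (r + stepLen k b) % N) a≡a′ ⟩
    (a′ % N + stepLen k b) % N    ≡⟨ [m%n+o]%n≡[m+o]%n a′ (stepLen k b) N ⟩
    (a′ + stepLen k b) % N        ∎))
    where open ≡-Reasoning

  -- all vertices lie in the window [a, a + N) of length N, on which reduction mod N is injective
  cycleVertices-unique : 1 ≤ k → ∀ a bs → walkLength k bs ≤ N → Unique (cycleVertices a bs)
  cycleVertices-unique 1≤k a []       _    = []
  cycleVertices-unique 1≤k a (b ∷ bs) len≤ =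
    All.tabulate a%N≢ ∷ cycleVertices-unique 1≤k (a + stepLen k b) bs (≤-trans (m≤n+m _ _) len≤)
    where
    a%N≢ : ∀ {x} → x ∈ cycleVertices (a + stepLen k b) bs → a % N ≢ x
    a%N≢ x∈ a%N≡x with ∈-map⁻ (_% N) x∈
    ... | y , y∈ , refl = <⇒≢ a<y (%-injective-window N a%N≡x (<⇒≤ a<y) y<a+N)
      where
      open ≤-Reasoning
      a<y : a < y
      a<y = begin-strict
        a                ≡⟨ +-identityʳ a ⟨
        a + 0            <⟨ +-monoʳ-< a (≤-trans 1≤k (k≤stepLen k b)) ⟩
        a + stepLen k b  ≤⟨ path-lb (positions⊆path y∈) ⟩
        y                ∎
      y<a+N : y < a + N
      y<a+N = begin-strict
        y                                  <⟨ m<m+n y 1≤k ⟩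
        y + k                              ≤⟨ positions-ub y∈ ⟩
        a + stepLen k b + walkLength k bs  ≡⟨ +-assoc a _ _ ⟩
        a + walkLength k (b ∷ bs)          ≤⟨ +-monoʳ-≤ a len≤ ⟩
        a + N                              ∎

  path⇒∈cycleVertices : ∀ {a bs z} → walkLength k bs ≡ N → z ∈ path k a bs → z % N ∈ cycleVertices a bs
  path⇒∈cycleVertices {bs = []} () _
  path⇒∈cycleVertices {a} {b ∷ bs} len z∈ with path-split z∈
  ... | inj₁ z∈ps = ∈-map⁺ (_% N) z∈ps
  ... | inj₂ refl = here (trans (cong (λ l → (a + l) % N) len) ([m+n]%n≡m%n a N))

  longArc⇒∈cycleVertices : ∀ {a bs y} → walkLength k bs ≡ N → LongArc k a bs y →
    y % N ∈ cycleVertices a bs × (y + suc k) % N ∈ cycleVertices a bs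
  longArc⇒∈cycleVertices len arc =
    ∈-map⁺ (_% N) (longArc⇒∈positions arc) , path⇒∈cycleVertices len (longArc⇒∈path arc)

  positions-ub-N : ∀ {a bs y} → walkLength k bs ≡ N → y ∈ positions k a bs → y + k ≤ a + N
  positions-ub-N {a} {y = y} len y∈ = subst (λ l → y + k ≤ a + l) len (positions-ub y∈)

  -- an arc from y₀ that wraps around mod N must start at a and end at the endpoint a + N
  wrappedArc-ends-at-end : 2 ≤ k → suc (suc k) ≤ N → ∀ {a bs y₀ y₁} → walkLength k bs ≡ N →
    y₀ ∈ positions k a bs → y₁ ∈ positions k a bs → (y₀ + suc k) % N ≡ y₁ % N →
    y₁ + N ≤ y₀ + suc k → y₀ + suc k ≡ a + walkLength k bs
  wrappedArc-ends-at-end 2≤k k+2≤N {a} {bs} {y₀} {y₁} len y₀∈ y₁∈ ≡mod y₁+N≤ =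
    trans (sym wrapped) (cong₂ _+_ y₁≡a (sym len))
    where
    open ≤-Reasoning
    y₀+k+1≤1+a+N : y₀ + suc k ≤ suc a + N
    y₀+k+1≤1+a+N = begin
      y₀ + suc k     ≡⟨ +-suc y₀ k ⟩
      suc (y₀ + k)   ≤⟨ s≤s (positions-ub-N len y₀∈) ⟩
      suc a + N      ∎
    wrapped : y₁ + N ≡ y₀ + suc k
    wrapped = %-injective-window N (trans ([m+n]%n≡m%n y₁ N) (sym ≡mod)) y₁+N≤ (begin-strict
      y₀ + suc k     ≤⟨ y₀+k+1≤1+a+N ⟩
      suc (a + N)    ≡⟨ +-comm 1 (a + N) ⟩
      a + N + 1      <⟨ +-monoʳ-< (a + N) (≤-trans (s≤s (s≤s z≤n)) k+2≤N) ⟩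
      a + N + N      ≤⟨ +-monoˡ-≤ N (+-monoˡ-≤ N (path-lb (positions⊆path y₁∈))) ⟩
      y₁ + N + N     ∎)
    y₁≡a : y₁ ≡ a
    y₁≡a with path-gap (positions⊆path y₁∈)
    ... | inj₁ y₁≡a   = y₁≡a
    ... | inj₂ a+k≤y₁ = ⊥-elim (1+n≰n (begin
      suc (suc a)   ≡⟨ +-comm 2 a ⟩
      a + 2         ≤⟨ +-monoʳ-≤ a 2≤k ⟩
      a + k         ≤⟨ a+k≤y₁ ⟩
      y₁            ≤⟨ +-cancelʳ-≤ N y₁ (suc a) (≤-trans (≤-reflexive wrapped) y₀+k+1≤1+a+N) ⟩
      suc a         ∎))

  arcTail∈path : 2 ≤ k → suc (suc k) ≤ N → ∀ {a bs y₀ y₁} → walkLength k bs ≡ N →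
    y₀ ∈ positions k a bs → y₁ ∈ positions k a bs → (y₀ + suc k) % N ≡ y₁ % N →
    y₀ + suc k ∈ path k a bs
  arcTail∈path 2≤k k+2≤N {a} {bs} {y₀} {y₁} len y₀∈ y₁∈ ≡mod with y₀ + suc k <? y₁ + N
  ... | no ≮y₁+N = subst (_∈ path k a bs)
                     (sym (wrappedArc-ends-at-end 2≤k k+2≤N len y₀∈ y₁∈ ≡mod (≮⇒≥ ≮y₁+N))) (end∈path a bs)
  ... | yes y₀+k+1<y₁+N with ≤-total (y₀ + suc k) y₁
  ...   | inj₂ y₁≤ =
    subst (_∈ path k a bs) (%-injective-window N (sym ≡mod) y₁≤ y₀+k+1<y₁+N) (positions⊆path y₁∈)
  ...   | inj₁ ≤y₁ =
    subst (_∈ path k a bs) (sym (%-injective-window N ≡mod ≤y₁ y₁<)) (positions⊆path y₁∈)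
    where
    open ≤-Reasoning
    y₁< : y₁ < y₀ + suc k + N
    y₁< = begin-strict
      y₁                <⟨ m<m+n y₁ (<⇒≤ 2≤k) ⟩
      y₁ + k            ≤⟨ positions-ub-N len y₁∈ ⟩
      a + N             ≤⟨ +-monoˡ-≤ N (≤-trans (path-lb (positions⊆path y₀∈)) (m≤m+n y₀ (suc k))) ⟩
      y₀ + suc k + N    ∎

  W⇒longArc : 2 ≤ k → suc (suc k) ≤ N → ∀ {a bs i} → walkLength k bs ≡ N → i < N →
    i ∈ cycleVertices a bs → subMod N i (suc k) ∈ cycleVertices a bs →
    ∃[ y ] LongArc k a bs y × y % N ≡ subMod N i (suc k) × (y + suc k) % N ≡ i
  W⇒longArc 2≤k k+2≤N {a} {bs} {i} len i<N i∈ i-k-1∈ with ∈-map⁻ (_% N) i∈ | ∈-map⁻ (_% N) i-k-1∈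
  ... | y₁ , y₁∈ , i≡ | y₀ , y₀∈ , i-k-1≡ =
    y₀ , gap⇒longArc 2≤k y₀∈ (arcTail∈path 2≤k k+2≤N len y₀∈ y₁∈ (trans y₀+k+1≡i i≡)) , sym i-k-1≡ , y₀+k+1≡i
    where
    open ≡-Reasoning
    y₀+k+1≡i : (y₀ + suc k) % N ≡ i
    y₀+k+1≡i = begin
      (y₀ + suc k) % N                  ≡⟨ [m%n+o]%n≡[m+o]%n y₀ (suc k) N ⟨
      (y₀ % N + suc k) % N              ≡⟨ cong (λ r → (r + suc k) % N) i-k-1≡ ⟨
      (subMod N i (suc k) + suc k) % N  ≡⟨ [subMod+b]%N≡a i (suc k) i<N k+2≤N ⟩
      i                                 ∎

count-++ : ∀ b xs ys → count b (xs ++ ys) ≡ count b xs + count b ys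
count-++ false xs ys = trans (cong length (filter-++ _ xs ys)) (length-++ (filter _ xs))
count-++ true  xs ys = trans (cong length (filter-++ _ xs ys)) (length-++ (filter _ xs))

count-replicate-false : ∀ M → count false (replicate M false) ≡ M × count true (replicate M false) ≡ 0
count-replicate-false zero    = refl , refl
count-replicate-false (suc M) = map₁ (cong suc) (count-replicate-false M)

splitAtLongArcs : ∀ c bs → c ≤ count true bs → ∃[ xs ] ∃[ ys ] (bs ≡ xs ++ ys × count true xs ≡ c)
splitAtLongArcs zero    bs           _        = [] , bs , refl , refl
splitAtLongArcs (suc c) (true ∷ bs)  (s≤s c≤) with splitAtLongArcs c bs c≤
... | xs , ys , refl , count≡ = true ∷ xs , ys , refl , cong suc count≡
splitAtLongArcs (suc c) (false ∷ bs) c≤       with splitAtLongArcs (suc c) bs c≤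
... | xs , ys , refl , count≡ = false ∷ xs , ys , refl , count≡

-- k arcs of length k+1 and k+1 arcs of length k have the same total length k(k+1)
record LongArcExchange (k t : ℕ) (bs : List Bool) : Set where
  field
    dropped kept : List Bool
    split        : bs ≡ dropped ++ kept
    padding      : ℕ
  exchanged : List Bool
  exchanged = kept ++ replicate padding false
  field
    walkLength-exchanged  : walkLength k exchanged ≡ walkLength k bs
    count-false-exchanged : count false exchanged ≡ count false bs + suc k * t
    count-true-exchanged  : count true bs ≡ k * t + count true exchanged

exchangeLongArcs : ∀ k t bs → k * t ≤ count true bs → LongArcExchange k t bs
exchangeLongArcs k t bs kt≤ with splitAtLongArcs (k * t) bs kt≤
... | dropped , kept , refl , count-dropped = record
  { dropped = dropped ; kept = kept ; split = refl ; padding = padding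
  ; walkLength-exchanged = begin
      walkLength k (kept ++ replicate padding false)     ≡⟨ walkLength-++ k kept _ ⟩
      walkLength k kept + walkLength k (replicate padding false)
                                                         ≡⟨ cong (walkLength k kept +_) (walkLength-replicate k padding) ⟩
      walkLength k kept + k * padding                    ≡⟨ cong (walkLength k kept +_) padding-length ⟨
      walkLength k kept + walkLength k dropped           ≡⟨ +-comm (walkLength k kept) _ ⟩
      walkLength k dropped + walkLength k kept           ≡⟨ walkLength-++ k dropped kept ⟨
      walkLength k (dropped ++ kept)                     ∎
  ; count-false-exchanged = begin
      count false (kept ++ replicate padding false)      ≡⟨ count-++ false kept _ ⟩
      count false kept + count false (replicate padding false)
                                                         ≡⟨ cong (count false kept +_) (proj₁ (count-replicate-false padding)) ⟩
      count false kept + (count false dropped + suc k * t) ≡⟨ +-assoc (count false kept) _ _ ⟨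
      count false kept + count false dropped + suc k * t ≡⟨ cong (_+ suc k * t) (+-comm (count false kept) _) ⟩
      count false dropped + count false kept + suc k * t ≡⟨ cong (_+ suc k * t) (count-++ false dropped kept) ⟨
      count false (dropped ++ kept) + suc k * t          ∎
  ; count-true-exchanged = begin
      count true (dropped ++ kept)                       ≡⟨ count-++ true dropped kept ⟩
      count true dropped + count true kept               ≡⟨ cong₂ _+_ count-dropped (sym (+-identityʳ (count true kept))) ⟩
      k * t + (count true kept + 0)                      ≡⟨ cong (λ c → k * t + (count true kept + c)) (proj₂ (count-replicate-false padding)) ⟨
      k * t + (count true kept + count true (replicate padding false))
                                                         ≡⟨ cong (k * t +_) (count-++ true kept _) ⟨
      k * t + count true (kept ++ replicate padding false) ∎
  }
  where
  open ≡-Reasoning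
  padding : ℕ
  padding = count false dropped + suc k * t
  padding-length : walkLength k dropped ≡ k * padding
  padding-length = begin
    walkLength k dropped                                  ≡⟨ walkLength-count k dropped ⟩
    k * count false dropped + suc k * count true dropped  ≡⟨ cong (λ c → k * count false dropped + suc k * c) count-dropped ⟩
    k * count false dropped + suc k * (k * t)             ≡⟨ regroup k (count false dropped) t ⟩
    k * padding                                           ∎
    where
    regroup : ∀ k f t → k * f + suc k * (k * t) ≡ k * (f + suc k * t)
    regroup = solve-∀

module _ (n0 k : ℕ) where
  open CycleGeometry n0 k

  exchangeCycle : 2 ≤ k → suc (suc k) ≤ N → (C : Cycle N k) → walkLength k (steps C) ≡ N →
    ∀ t → k * t ≤ n₃ C →
    Σ (Cycle N k) λ C′ → walkLength k (steps C′) ≡ N × n₂ C′ ≡ n₂ C + suc k * t ×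
                          n₃ C ≡ k * t + n₃ C′ × (∀ i → InW C′ i → InW C i)
  exchangeCycle 2≤k k+2≤N C len t kt≤ =
    C′ , len′ , count-false-exchanged , count-true-exchanged , InW-C′⇒InW-C
    where
    open LongArcExchange (exchangeLongArcs k t (steps C) kt≤)
    a a′ : ℕ
    a = toℕ (start C)
    a′ = a + walkLength k dropped
    len′ : walkLength k exchanged ≡ N
    len′ = trans walkLength-exchanged len
    C′ : Cycle N k
    C′ = record
      { start    = fromℕ< (m%n<n a′ N)
      ; steps    = exchanged
      ; nonempty = walkLength≡suc⇒nonempty {k} {exchanged} len′
      ; distinct = cycleVertices-unique (<⇒≤ 2≤k) _ exchanged (≤-reflexive len′)
      }
    vertices-C′ : vertices C′ ≡ cycleVertices a′ exchanged
    vertices-C′ = cycleVertices-cong exchanged (trans (cong (_% N) (toℕ-fromℕ< (m%n<n a′ N))) (m%n%n≡m%n a′ N))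
    InW-C′⇒InW-C : ∀ i → InW C′ i → InW C i
    InW-C′⇒InW-C i (i∈ , i-k-1∈)
      with W⇒longArc 2≤k k+2≤N len′ (toℕ<n i) (subst (_ ∈_) vertices-C′ i∈) (subst (_ ∈_) vertices-C′ i-k-1∈)
    ... | y , arc , y≡ , y+k+1≡ = subst (_∈ vertices C) y+k+1≡ (proj₂ inC) , subst (_∈ vertices C) y≡ (proj₁ inC)
      where
      inC : y % N ∈ vertices C × (y + suc k) % N ∈ vertices C
      inC = longArc⇒∈cycleVertices len
              (subst (λ bs → LongArc k a bs y) (sym split) (longArc-++ˡ dropped (longArc-padded kept padding arc)))

subsetOf : ∀ {n} {P : Fin n → Set} → Decidable P → Subset n
subsetOf P? = tabulate (λ i → does (P? i))

∈-subsetOf : ∀ {n} {P : Fin n → Set} (P? : Decidable P) i → i ∈ₛ subsetOf P? ⇔ P i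
∈-subsetOf P? i = mk⇔
  (λ i∈ → toWitness {a? = P? i} (Equivalence.from T-≡
    (trans (isYes≗does (P? i)) (trans (sym (lookup∘tabulate _ i)) ([]=⇒lookup i∈)))))
  (λ Pi → lookup⇒[]= i _ (trans (lookup∘tabulate _ i) (dec-true (P? i) Pi)))

InW? : ∀ {n k} (C : Cycle n k) → Decidable (InW C)
InW? {n} {k} C i = (toℕ i ∈? vertices C) ×-dec (subMod n (toℕ i) (suc k) ∈? vertices C)

cycleW : ∀ {n k} → Cycle n k → Subset n
cycleW C = subsetOf (InW? C)

cycleW-defines : ∀ {n k} (C : Cycle n k) → walkLength k (steps C) ≡ n →
  Defines n k (cycleW C) 1 1 (n₂ C) (n₃ C)
cycleW-defines {n} {k} C len = minor , λ i → mk⇔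
  (λ i∈ → zero , Equivalence.to (∈-subsetOf (InW? C) i) i∈)
  (λ { (zero , w) → Equivalence.from (∈-subsetOf (InW? C) i) w })
  where
  minor : MinorData n k 1 1 (n₂ C) (n₃ C)
  minor = record
    { cyc      = λ _ → C
    ; n2-eq    = λ _ → refl
    ; n3-eq    = λ _ → refl
    ; n1-pos   = s≤s z≤n
    ; winding  = trans (*-identityˡ n) (trans (sym len) (walkLength-count k (steps C)))
    ; disjoint = λ { zero zero 0≢0 _ _ _ → 0≢0 refl }
    }

cycleW-⊆ : ∀ {n k} (C : Cycle n k) {W : Subset n} → (∀ i → InW C i → i ∈ₛ W) → cycleW C ⊆ W
cycleW-⊆ C InW⇒∈W {i} i∈ = InW⇒∈W i (Equivalence.to (∈-subsetOf (InW? C) i) i∈)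

lemma3p8 : (n k : ℕ) → 2 ≤ k → k + 2 ≤ n →
  (W : Subset n) (n2 n3 : ℕ) →
  Defines n k W 1 1 n2 n3 →
  Relevant n k (n′ n 1 n2 n3) (k′ k 1 1) →
  Σ (Subset n) λ W' → W' ⊆ W ×
    (∃[ d ] ∃[ n1 ] ∃[ m2 ] ∃[ m3 ]
      (Defines n k W' d n1 m2 m3 ×
       k′ k d n1 ≡ k′ k 1 1 ×
       Relevant n k (n′ n d m2 m3) (k′ k d n1) ×
       modN (n′ n d m2 m3) (k′ k 1 1) ≡ modN 1 (k′ k 1 1) ×
       ceilDiv (n′ n d m2 m3) (k′ k 1 1) ≥ ceilDiv (n′ n 1 n2 n3) (k′ k 1 1)))
lemma3p8 (suc n0) k@(suc (suc b)) 2≤k k+2≤n _ n2 n3 (minor , W⇔) relevant@(1≤k′ , _ , ceil<) =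
  let t , x , 1+t<k′ , n3≡ = relevant⇒long-arc-surplus b n2 n3 N≡ relevant
      C′ , len′ , n2′≡ , n3≡′ , InW-C′⇒InW-C =
        exchangeCycle n0 k 2≤k k+2≤N C len t (subst (k * t ≤_) (sym (trans (n3-eq zero) n3≡)) (m≤m+n (k * t) _))
      n″≡1 , n″≢0 , ceil≡ = exchange-numbers b n2 n3 (n₂ C′) (n₃ C′) t x N≡ 1+t<k′ n3≡
        (trans (sym (n3-eq zero)) n3≡′) (trans n2′≡ (cong (_+ suc k * t) (n2-eq zero)))
  in cycleW C′ , cycleW-⊆ C′ (λ i w → Equivalence.from (W⇔ i) (zero , InW-C′⇒InW-C i w)) ,
     1 , 1 , n₂ C′ , n₃ C′ , cycleW-defines C′ len′ , refl ,
     (1≤k′ , n″≢0 , subst (ceilDiv (suc n0) k <_) (sym ceil≡) ceil<) , n″≡1 , ≤-reflexive (sym ceil≡)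
  where
  open MinorData minor
  C : Cycle (suc n0) k
  C = cyc zero
  k+2≤N : suc (suc k) ≤ suc n0
  k+2≤N = subst (_≤ suc n0) (+-comm k 2) k+2≤n
  N≡ : suc n0 ≡ k * n2 + suc k * n3
  N≡ = trans (sym (*-identityˡ (suc n0))) winding
  len : walkLength k (steps C) ≡ suc n0
  len = trans (walkLength-count k (steps C))
              (trans (cong₂ (λ f t → k * f + suc k * t) (n2-eq zero) (n3-eq zero)) (sym N≡))
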